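{- Let $A$ be a binary matrix and let $U$ and $V$ be two bases of $A$, both in the binary setting or both in the boolean setting. Then at most one of $U$, $V$ spans the other.
   Context: A binary matrix has entries in $\{0,1\}$. A set $X$ of binary vectors spans a set $Y$ in the binary (resp. boolean) setting if every vector of $Y$ is a linear combination of vectors of $X$ with coefficients in $\{0,1\}$ using ordinary (resp. boolean, $1+1=1$) addition. A base of an $n\times m$ binary matrix $A$ is a set of vectors in $\{0,1\}^n$ spanning all columns of $A$, of minimum cardinality among all such spanning sets (its size equals the binary, resp. boolean, rank of $A$). Bases $U,V$ here are understood to be distinct. -}

module Defs where

open import Data.Bool using (Bool; true; false; _∨_)
open import Data.Nat using (ℕ; zero; suc; _+_; _≤_)
open import Data.Fin using (Fin)
open import Data.Vec using (Vec; lookup)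
open import Data.List using (List; []; _∷_; length)
open import Data.List.Relation.Unary.All using (All)
open import Data.List.Relation.Unary.Unique.Propositional using (Unique)
open import Data.List.Relation.Binary.Sublist.Propositional using (_⊆_)
open import Data.List.Membership.Propositional using (_∈_)
open import Data.Product using (∃; _×_)
open import Relation.Binary.PropositionalEquality using (_≡_)
open import Function.Bundles using (_⇔_)

BinVec : ℕ → Set
BinVec n = Vec Bool n

-- an n×m binary matrix, given as the vector of its m columns
BinMatrix : ℕ → ℕ → Set
BinMatrix n m = Vec (BinVec n) m

data Setting : Set where
  binary boolean : Setting

bit : Bool → ℕ
bit false = 0
bit true  = 1

coordSumℕ : ∀ {n} → List (BinVec n) → Fin n → ℕ
coordSumℕ []       i = 0
coordSumℕ (x ∷ xs) i = bit (lookup x i) + coordSumℕ xs i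

coordSumBool : ∀ {n} → List (BinVec n) → Fin n → Bool
coordSumBool []       i = false
coordSumBool (x ∷ xs) i = lookup x i ∨ coordSumBool xs i

SumEq : Setting → ∀ {n} → List (BinVec n) → BinVec n → Set
SumEq binary  ys y = ∀ i → coordSumℕ ys i ≡ bit (lookup y i)
SumEq boolean ys y = ∀ i → coordSumBool ys i ≡ lookup y i

-- y is a {0,1}-linear combination of the vectors of X: choosing coefficient 1
-- for the members of a sub-list ys of X and 0 for the others
InSpan : Setting → ∀ {n} → List (BinVec n) → BinVec n → Set
InSpan s X y = ∃ λ ys → ys ⊆ X × SumEq s ys y

Spans : Setting → ∀ {n} → List (BinVec n) → List (BinVec n) → Set
Spans s X Y = All (InSpan s X) Y

SpansColumns : Setting → ∀ {n m} → List (BinVec n) → BinMatrix n m → Set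
SpansColumns s X A = ∀ j → InSpan s X (lookup A j)

-- a base of A: a finite set (duplicate-free list) of vectors of {0,1}^n spanning
-- all columns of A, of minimum cardinality among all such spanning sets
IsBase : Setting → ∀ {n m} → BinMatrix n m → List (BinVec n) → Set
IsBase s {n} A U =
  Unique U × SpansColumns s U A ×
  (∀ (W : List (BinVec n)) → Unique W → SpansColumns s W A → length U ≤ length W)

SameSet : ∀ {n} → List (BinVec n) → List (BinVec n) → Set
SameSet U V = ∀ x → (x ∈ U) ⇔ (x ∈ V)

-- If U and V span each other, then any u ∈ U outside V is a sum of vectors of V, each of which
-- is a sum of vectors of U.  Since in both settings a summand lies coordinatewise below the sum,
-- u cannot occur in the second layer of sums (it would then equal a vector of V), so U ∖ {u}
-- already spans u and hence all columns of A, contradicting the minimality of the base U.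
-- Hence mutually spanning bases contain each other.  That a span of spans is a span is clear in
-- the boolean setting; in the binary one the composed ℕ-combination has all coordinates ≤ 1,
-- which forces the coefficient of every nonzero vector to be 0 or 1.
module Submission where

open import Defs
open import Data.Bool using (Bool; true; false; _∧_; _∨_; b≤b)
import Data.Bool as Bool
import Data.Bool.Properties as Boolₚ
open import Data.Nat using (ℕ; zero; suc; _+_; _*_; _≤_; z≤n; s≤s)
open import Data.Nat.Properties
  using (≤-refl; ≤-trans; m≤m+n; m≤n+m; m+n≤o⇒n≤o; *-zeroʳ; *-identityˡ; +-identityʳ; *-distribʳ-+;
         +-commutativeSemigroup; 1+n≰n)
open import Data.Fin using (Fin)
open import Data.Vec using (Vec; []; _∷_; lookup; replicate; zipWith; tabulate)
open import Data.Vec.Properties using (≡-dec; tabulate∘lookup; tabulate-cong)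
open import Data.List using (List; []; _∷_; length; _++_)
open import Data.List.Properties using (length-++-sucʳ)
open import Data.List.Relation.Unary.All as All using (All; []; _∷_)
open import Data.List.Relation.Unary.All.Properties using (++⁺)
open import Data.List.Relation.Unary.Any using (here; there)
open import Data.List.Relation.Unary.AllPairs using ([]; _∷_)
open import Data.List.Relation.Unary.Unique.Propositional using (Unique)
open import Data.List.Relation.Binary.Sublist.Propositional using (_⊆_; []; _∷_; _∷ʳ_; ⊆-refl; from∈)
import Data.List.Relation.Binary.Sublist.Propositional as Sublist
import Data.List.Relation.Binary.Sublist.Propositional.Properties as Sublistₚ
open import Data.List.Membership.Propositional using (_∈_; _∉_)
open import Data.List.Membership.Propositional.Properties using (∈-∃++; ∈-++⁺ˡ; ∈-++⁺ʳ)
open import Data.Product using (_×_; _,_; ∃)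
open import Data.Empty using (⊥-elim)
open import Relation.Nullary using (¬_; yes; no)
open import Relation.Binary.PropositionalEquality using (_≡_; refl; sym; trans; cong; cong₂; subst; module ≡-Reasoning)
open import Function.Base using (_∘_)
open import Function.Bundles using (mk⇔)
open import Algebra.Properties.CommutativeSemigroup +-commutativeSemigroup
  renaming (interchange to +-interchange)
open import Algebra.Bundles using (module CommutativeMonoid)
open import Algebra.Properties.CommutativeSemigroup (CommutativeMonoid.commutativeSemigroup Boolₚ.∨-commutativeMonoid)
  renaming (interchange to ∨-interchange)

Unique-resp-⊆ : ∀ {a} {A : Set a} {xs ys : List A} → xs ⊆ ys → Unique ys → Unique xs
Unique-resp-⊆ []         []          = []
Unique-resp-⊆ (_ ∷ʳ τ)   (_ ∷ uniq)  = Unique-resp-⊆ τ uniq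
Unique-resp-⊆ (refl ∷ τ) (y∉ ∷ uniq) = Sublistₚ.All-resp-⊆ τ y∉ ∷ Unique-resp-⊆ τ uniq

⊆-remove : ∀ {a} {A : Set a} (P : List A) {u : A} {Q xs : List A} →
           xs ⊆ P ++ u ∷ Q → u ∉ xs → xs ⊆ P ++ Q
⊆-remove []      (_ ∷ʳ τ)   u∉ = τ
⊆-remove []      (refl ∷ τ) u∉ with () ← u∉ (here refl)
⊆-remove (p ∷ P) (_ ∷ʳ τ)   u∉ = p ∷ʳ ⊆-remove P τ u∉
⊆-remove (p ∷ P) (refl ∷ τ) u∉ = refl ∷ ⊆-remove P τ (u∉ ∘ there)

module _ {n : ℕ} where

  _⊑_ : BinVec n → BinVec n → Set
  u ⊑ v = ∀ i → lookup u i Bool.≤ lookup v i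

  ⊑-antisym : ∀ {u v} → u ⊑ v → v ⊑ u → u ≡ v
  ⊑-antisym {u} {v} u⊑v v⊑u = begin
    u                   ≡⟨ tabulate∘lookup u ⟨
    tabulate (lookup u) ≡⟨ tabulate-cong (λ i → Boolₚ.≤-antisym (u⊑v i) (v⊑u i)) ⟩
    tabulate (lookup v) ≡⟨ tabulate∘lookup v ⟩
    v                   ∎
    where open ≡-Reasoning

  bit-≤-coordSumℕ : ∀ {w : BinVec n} {ys} i → w ∈ ys → bit (lookup w i) ≤ coordSumℕ ys i
  bit-≤-coordSumℕ {ys = y ∷ ys} i (here refl) = m≤m+n _ _
  bit-≤-coordSumℕ {ys = y ∷ ys} i (there w∈) = ≤-trans (bit-≤-coordSumℕ i w∈) (m≤n+m _ _)

  lookup-≤-coordSumBool : ∀ {w : BinVec n} {ys} i → w ∈ ys → lookup w i Bool.≤ coordSumBool ys i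
  lookup-≤-coordSumBool {ys = y ∷ ys} i (here refl) = x≤x∨y (lookup y i) _
    where
    x≤x∨y : ∀ x y → x Bool.≤ x ∨ y
    x≤x∨y false y = Boolₚ.≤-minimum y
    x≤x∨y true  y = b≤b
  lookup-≤-coordSumBool {ys = y ∷ ys} i (there w∈) = ≤⇒≤∨ (lookup y i) (lookup-≤-coordSumBool i w∈)
    where
    ≤⇒≤∨ : ∀ x {a b} → a Bool.≤ b → a Bool.≤ x ∨ b
    ≤⇒≤∨ false a≤b = a≤b
    ≤⇒≤∨ true  a≤b = Boolₚ.≤-maximum _

  bit-reflects-≤ : ∀ {a b} → bit a ≤ bit b → a Bool.≤ b
  bit-reflects-≤ {false} {b}     _ = Boolₚ.≤-minimum b
  bit-reflects-≤ {true}  {true}  _ = b≤b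

  summand-⊑-sum : ∀ s {ys} {w y : BinVec n} → SumEq s ys y → w ∈ ys → w ⊑ y
  summand-⊑-sum binary  y≡ w∈ i = bit-reflects-≤ (subst (_ ≤_) (y≡ i) (bit-≤-coordSumℕ i w∈))
  summand-⊑-sum boolean y≡ w∈ i = subst (_ Bool.≤_) (y≡ i) (lookup-≤-coordSumBool i w∈)

  combinationℕ : (Z : List (BinVec n)) → Vec ℕ (length Z) → Fin n → ℕ
  combinationℕ []      []       i = 0
  combinationℕ (z ∷ Z) (c ∷ cs) i = c * bit (lookup z i) + combinationℕ Z cs i

  combinationℕ-zero : ∀ Z i → combinationℕ Z (replicate (length Z) 0) i ≡ 0
  combinationℕ-zero []      i = refl
  combinationℕ-zero (z ∷ Z) i = combinationℕ-zero Z i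

  combinationℕ-+ : ∀ Z cs ds i →
                   combinationℕ Z (zipWith _+_ cs ds) i ≡ combinationℕ Z cs i + combinationℕ Z ds i
  combinationℕ-+ []      []       []       i = refl
  combinationℕ-+ (z ∷ Z) (c ∷ cs) (d ∷ ds) i = begin
    (c + d) * b + combinationℕ Z (zipWith _+_ cs ds) i
      ≡⟨ cong₂ _+_ (*-distribʳ-+ b c d) (combinationℕ-+ Z cs ds i) ⟩
    (c * b + d * b) + (combinationℕ Z cs i + combinationℕ Z ds i)
      ≡⟨ +-interchange (c * b) (d * b) _ _ ⟩
    (c * b + combinationℕ Z cs i) + (d * b + combinationℕ Z ds i) ∎
    where
    open ≡-Reasoning
    b = bit (lookup z i)

  ⊆⇒combinationℕ : ∀ {ys Z} → ys ⊆ Z → ∃ λ cs → ∀ i → coordSumℕ ys i ≡ combinationℕ Z cs i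
  ⊆⇒combinationℕ []         = [] , λ _ → refl
  ⊆⇒combinationℕ (_ ∷ʳ τ)   = let cs , ys≡ = ⊆⇒combinationℕ τ in 0 ∷ cs , ys≡
  ⊆⇒combinationℕ (refl ∷ τ) = let cs , ys≡ = ⊆⇒combinationℕ τ in
    1 ∷ cs , λ i → cong₂ _+_ (sym (*-identityˡ _)) (ys≡ i)

  *-bit-≤1⇒≡bit : ∀ c b r → suc c * bit b + r ≤ 1 → suc c * bit b ≡ bit b
  *-bit-≤1⇒≡bit c       false r _ = *-zeroʳ (suc c)
  *-bit-≤1⇒≡bit zero    true  r _ = refl
  *-bit-≤1⇒≡bit (suc c) true  r (s≤s ())

  combinationℕ≤1⇒⊆ : ∀ Z cs → (∀ i → combinationℕ Z cs i ≤ 1) →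
                     ∃ λ ys → ys ⊆ Z × ∀ i → coordSumℕ ys i ≡ combinationℕ Z cs i
  combinationℕ≤1⇒⊆ []      []           _  = [] , [] , λ _ → refl
  combinationℕ≤1⇒⊆ (z ∷ Z) (zero ∷ cs)  ≤1 =
    let ys , τ , ys≡ = combinationℕ≤1⇒⊆ Z cs (λ i → m+n≤o⇒n≤o _ (≤1 i)) in ys , z ∷ʳ τ , ys≡
  combinationℕ≤1⇒⊆ (z ∷ Z) (suc c ∷ cs) ≤1 =
    let ys , τ , ys≡ = combinationℕ≤1⇒⊆ Z cs (λ i → m+n≤o⇒n≤o _ (≤1 i)) in
    z ∷ ys , refl ∷ τ , λ i → cong₂ _+_ (sym (*-bit-≤1⇒≡bit c (lookup z i) _ (≤1 i))) (ys≡ i)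

  Spans⇒combinationℕ : ∀ {Z} ys → All (InSpan binary Z) ys →
                       ∃ λ cs → ∀ i → coordSumℕ ys i ≡ combinationℕ Z cs i
  Spans⇒combinationℕ {Z} []       []                      =
    replicate (length Z) 0 , λ i → sym (combinationℕ-zero Z i)
  Spans⇒combinationℕ {Z} (y ∷ ys) ((xs , τ , y≡) ∷ Z⇉ys) =
    let cs , xs≡ = ⊆⇒combinationℕ τ
        ds , ys≡ = Spans⇒combinationℕ ys Z⇉ys
    in zipWith _+_ cs ds , λ i → begin
      bit (lookup y i) + coordSumℕ ys i                 ≡⟨ cong₂ _+_ (sym (y≡ i)) (ys≡ i) ⟩
      coordSumℕ xs i + combinationℕ Z ds i              ≡⟨ cong (_+ _) (xs≡ i) ⟩
      combinationℕ Z cs i + combinationℕ Z ds i         ≡⟨ combinationℕ-+ Z cs ds i ⟨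
      combinationℕ Z (zipWith _+_ cs ds) i              ∎
    where open ≡-Reasoning

  bit≤1 : ∀ b → bit b ≤ 1
  bit≤1 false = z≤n
  bit≤1 true  = ≤-refl

  InSpan-trans-binary : ∀ {X Z} {y : BinVec n} → InSpan binary X y → Spans binary Z X → InSpan binary Z y
  InSpan-trans-binary {Z = Z} {y} (ys , τ , y≡) Z⇉X =
    let cs , ys≡ = Spans⇒combinationℕ ys (Sublistₚ.All-resp-⊆ τ Z⇉X)
        y≡cs i   = trans (sym (y≡ i)) (ys≡ i)
        zs , σ , zs≡ = combinationℕ≤1⇒⊆ Z cs (λ i → subst (_≤ 1) (y≡cs i) (bit≤1 (lookup y i)))
    in zs , σ , λ i → trans (zs≡ i) (sym (y≡cs i))

  combinationᴮ : (Z : List (BinVec n)) → Vec Bool (length Z) → Fin n → Bool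
  combinationᴮ []      []       i = false
  combinationᴮ (z ∷ Z) (c ∷ cs) i = c ∧ lookup z i ∨ combinationᴮ Z cs i

  combinationᴮ-false : ∀ Z i → combinationᴮ Z (replicate (length Z) false) i ≡ false
  combinationᴮ-false []      i = refl
  combinationᴮ-false (z ∷ Z) i = combinationᴮ-false Z i

  combinationᴮ-∨ : ∀ Z cs ds i →
                   combinationᴮ Z (zipWith _∨_ cs ds) i ≡ combinationᴮ Z cs i ∨ combinationᴮ Z ds i
  combinationᴮ-∨ []      []       []       i = refl
  combinationᴮ-∨ (z ∷ Z) (c ∷ cs) (d ∷ ds) i = begin
    (c ∨ d) ∧ b ∨ combinationᴮ Z (zipWith _∨_ cs ds) i
      ≡⟨ cong₂ _∨_ (Boolₚ.∧-distribʳ-∨ b c d) (combinationᴮ-∨ Z cs ds i) ⟩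
    (c ∧ b ∨ d ∧ b) ∨ (combinationᴮ Z cs i ∨ combinationᴮ Z ds i)
      ≡⟨ ∨-interchange (c ∧ b) (d ∧ b) _ _ ⟩
    (c ∧ b ∨ combinationᴮ Z cs i) ∨ (d ∧ b ∨ combinationᴮ Z ds i) ∎
    where
    open ≡-Reasoning
    b = lookup z i

  ⊆⇒combinationᴮ : ∀ {ys Z} → ys ⊆ Z → ∃ λ cs → ∀ i → coordSumBool ys i ≡ combinationᴮ Z cs i
  ⊆⇒combinationᴮ []         = [] , λ _ → refl
  ⊆⇒combinationᴮ (_ ∷ʳ τ)   = let cs , ys≡ = ⊆⇒combinationᴮ τ in false ∷ cs , ys≡
  ⊆⇒combinationᴮ (refl ∷ τ) = let cs , ys≡ = ⊆⇒combinationᴮ τ in true ∷ cs , λ i → cong (_ ∨_) (ys≡ i)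

  combinationᴮ⇒⊆ : ∀ Z cs → ∃ λ ys → ys ⊆ Z × ∀ i → coordSumBool ys i ≡ combinationᴮ Z cs i
  combinationᴮ⇒⊆ []      []           = [] , [] , λ _ → refl
  combinationᴮ⇒⊆ (z ∷ Z) (false ∷ cs) = let ys , τ , ys≡ = combinationᴮ⇒⊆ Z cs in ys , z ∷ʳ τ , ys≡
  combinationᴮ⇒⊆ (z ∷ Z) (true ∷ cs)  =
    let ys , τ , ys≡ = combinationᴮ⇒⊆ Z cs in z ∷ ys , refl ∷ τ , λ i → cong (_ ∨_) (ys≡ i)

  Spans⇒combinationᴮ : ∀ {Z} ys → All (InSpan boolean Z) ys →
                       ∃ λ cs → ∀ i → coordSumBool ys i ≡ combinationᴮ Z cs i
  Spans⇒combinationᴮ {Z} []       []                      =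
    replicate (length Z) false , λ i → sym (combinationᴮ-false Z i)
  Spans⇒combinationᴮ {Z} (y ∷ ys) ((xs , τ , y≡) ∷ Z⇉ys) =
    let cs , xs≡ = ⊆⇒combinationᴮ τ
        ds , ys≡ = Spans⇒combinationᴮ ys Z⇉ys
    in zipWith _∨_ cs ds , λ i → begin
      lookup y i ∨ coordSumBool ys i                    ≡⟨ cong₂ _∨_ (sym (y≡ i)) (ys≡ i) ⟩
      coordSumBool xs i ∨ combinationᴮ Z ds i           ≡⟨ cong (_∨ _) (xs≡ i) ⟩
      combinationᴮ Z cs i ∨ combinationᴮ Z ds i         ≡⟨ combinationᴮ-∨ Z cs ds i ⟨
      combinationᴮ Z (zipWith _∨_ cs ds) i              ∎
    where open ≡-Reasoning

  InSpan-trans-boolean : ∀ {X Z} {y : BinVec n} → InSpan boolean X y → Spans boolean Z X → InSpan boolean Z y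
  InSpan-trans-boolean {Z = Z} (ys , τ , y≡) Z⇉X =
    let cs , ys≡     = Spans⇒combinationᴮ ys (Sublistₚ.All-resp-⊆ τ Z⇉X)
        zs , σ , zs≡ = combinationᴮ⇒⊆ Z cs
    in zs , σ , λ i → trans (zs≡ i) (trans (sym (ys≡ i)) (y≡ i))

InSpan-trans : ∀ s {n} {X Z} {y : BinVec n} → InSpan s X y → Spans s Z X → InSpan s Z y
InSpan-trans binary  {y = y} = InSpan-trans-binary  {y = y}
InSpan-trans boolean {y = y} = InSpan-trans-boolean {y = y}

InSpan-∈ : ∀ s {n} {Z} {w : BinVec n} → w ∈ Z → InSpan s Z w
InSpan-∈ s {w = w} w∈ = w ∷ [] , from∈ w∈ , singleton-sum s
  where
  singleton-sum : ∀ s → SumEq s (w ∷ []) w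
  singleton-sum binary  i = +-identityʳ _
  singleton-sum boolean i = Boolₚ.∨-identityʳ _

module _ (s : Setting) {n m : ℕ} {A : BinMatrix n m} where

  open import Data.List.Membership.DecPropositional (≡-dec {n = n} Boolₚ._≟_) using (_∈?_)

  base-element-∉-span-of-rest : ∀ P {u} Q → IsBase s A (P ++ u ∷ Q) → ¬ InSpan s (P ++ Q) u
  base-element-∉-span-of-rest P {u} Q (unique , U⇉A , minimal) rest⇉u =
    1+n≰n (subst (_≤ length (P ++ Q)) (length-++-sucʳ P u Q)
                 (minimal (P ++ Q) (Unique-resp-⊆ rest⊆U unique) (λ j → InSpan-trans s (U⇉A j) rest⇉U)))
    where
    rest⊆U : P ++ Q ⊆ P ++ u ∷ Q
    rest⊆U = Sublistₚ.++⁺ ⊆-refl (u ∷ʳ ⊆-refl)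
    rest⇉U : Spans s (P ++ Q) (P ++ u ∷ Q)
    rest⇉U = ++⁺ (All.tabulate (InSpan-∈ s ∘ ∈-++⁺ˡ)) (rest⇉u ∷ All.tabulate (InSpan-∈ s ∘ ∈-++⁺ʳ P))

  -- If u were a summand of some v ∈ V with v a summand of u, then u ⊑ v ⊑ u would put u in V.
  InSpan-avoiding : ∀ P {u : BinVec n} Q {V} → u ∉ V → InSpan s V u → Spans s (P ++ u ∷ Q) V →
                    InSpan s (P ++ Q) u
  InSpan-avoiding P {u} Q {V} u∉V (S , S⊆V , u≡) U⇉V =
    InSpan-trans s (S , ⊆-refl , u≡) (All.tabulate rest⇉v)
    where
    rest⇉v : ∀ {v} → v ∈ S → InSpan s (P ++ Q) v
    rest⇉v v∈S with (T , T⊆U , v≡) ← All.lookup U⇉V (Sublist.lookup S⊆V v∈S) =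
      T , ⊆-remove P T⊆U u∉T , v≡
      where
      u∉T : u ∉ T
      u∉T u∈T = u∉V (subst (_∈ V) (⊑-antisym (summand-⊑-sum s u≡ v∈S) (summand-⊑-sum s v≡ u∈T))
                                  (Sublist.lookup S⊆V v∈S))

  base-⊆-mutually-spanning : ∀ {U V} → IsBase s A U → Spans s U V → Spans s V U → ∀ {u} → u ∈ U → u ∈ V
  base-⊆-mutually-spanning {V = V} base U⇉V V⇉U {u} u∈U with u ∈? V
  ... | yes u∈V = u∈V
  ... | no  u∉V with P , Q , refl ← ∈-∃++ u∈U =
    ⊥-elim (base-element-∉-span-of-rest P Q base (InSpan-avoiding P Q u∉V (All.lookup V⇉U u∈U) U⇉V))

mainTheorem11 : (s : Setting) (n m : ℕ) (A : BinMatrix n m) (U V : List (BinVec n)) →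
    IsBase s A U → IsBase s A V → ¬ SameSet U V →
    ¬ (Spans s U V × Spans s V U)
mainTheorem11 s n m A U V U-base V-base U≠V (U⇉V , V⇉U) =
  U≠V λ _ → mk⇔ (base-⊆-mutually-spanning s {A = A} U-base U⇉V V⇉U)
                (base-⊆-mutually-spanning s {A = A} V-base V⇉U U⇉V)
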